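{- Let $\epsilon_n$ be the number of skew-symmetric $(n,n)$-clans whose base clan is $\underbrace{ -\cdots- }_{n}\underbrace{+\cdots+}_{n}$ for $n\ge1$, and set $\epsilon_0=1$. Then $\epsilon_n=2\epsilon_{n-1}+(n-1)\epsilon_{n-2}$ for all $n\ge2$, and $$\sum_{n=0}^\infty\epsilon_n\frac{x^n}{n!}=e^{2x+\frac{x^2}{2}}.$$
   Context: An $(n,n)$-clan is a string $\gamma=c_1\cdots c_{2n}$ of symbols from $\mathbb{N}\cup\{+,-\}$ such that each natural number appearing appears exactly twice and the numbers of $+$'s and $-$'s are equal; clans are equal if they have the same $\pm$ symbols in the same positions and the same sets of positions of matching pairs. $\gamma$ is skew-symmetric if $\gamma=-rev(\gamma)$, where $rev$ reverses the string and $-$ interchanges $+$ and $-$. The base clan of $\gamma$ is obtained by replacing, for each matching pair $c_i=c_j\in\mathbb N$ with $i<j$, the symbol $c_i$ by $-$ and $c_j$ by $+$. -}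

module Defs where

open import Data.Nat using (ℕ; zero; suc; _+_; _*_; _∸_; _<ᵇ_; _!)
open import Data.Nat.Properties using (_!≢0)
open import Data.Fin using (Fin; toℕ; opposite) renaming (_≟_ to _≟F_)
open import Data.Fin.Properties using (all?)
open import Data.Vec using (Vec; []; _∷_; lookup; tabulate; count)
import Data.Vec.Properties as VP
open import Data.List using (List; []; _∷_; [_]; map; concatMap; allFin; filter; length; foldr; upTo)
open import Data.Bool using (if_then_else_)
open import Data.Product using (_×_; _,_)
open import Data.Unit using (⊤; tt)
open import Data.Integer using (+_)
open import Data.Rational using (ℚ; 0ℚ; 1ℚ; _/_) renaming (_+_ to _+ℚ_; _*_ to _*ℚ_)
open import Relation.Nullary using (¬_; Dec; yes; no; _×-dec_; ¬?)
open import Relation.Nullary.Decidable using (map′)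
open import Relation.Binary.PropositionalEquality using (_≡_; refl; cong)
open import Data.Nat using () renaming (_≟_ to _≟ℕ_)

-- A natural-number symbol is recorded by the POSITION of its partner:
-- 'num j' at position i means c_i = c_j is a natural number.
-- This encodes a clan exactly up to the paper's notion of equality
-- (same ± symbols in the same positions, same sets of matching pairs).

data Sym (m : ℕ) : Set where
  plus  : Sym m
  minus : Sym m
  num   : Fin m → Sym m

num-inj : ∀ {m} {i j : Fin m} → num i ≡ num j → i ≡ j
num-inj refl = refl

_≟S_ : ∀ {m} (a b : Sym m) → Dec (a ≡ b)
plus  ≟S plus  = yes refl
plus  ≟S minus = no λ ()
plus  ≟S num _ = no λ ()
minus ≟S plus  = no λ ()
minus ≟S minus = yes refl
minus ≟S num _ = no λ ()
num _ ≟S plus  = no λ ()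
num _ ≟S minus = no λ ()
num i ≟S num j = map′ (cong num) num-inj (i ≟F j)

Word : ℕ → Set
Word n = Vec (Sym (n + n)) (n + n)

PairOK′ : ∀ {m} → Vec (Sym m) m → Fin m → Sym m → Set
PairOK′ v i plus    = ⊤
PairOK′ v i minus   = ⊤
PairOK′ v i (num j) = (¬ j ≡ i) × (lookup v j ≡ num i)

PairOK : ∀ {m} → Vec (Sym m) m → Fin m → Set
PairOK v i = PairOK′ v i (lookup v i)

IsClan : ∀ n → Word n → Set
IsClan n v = (∀ i → PairOK v i) × (count (_≟S plus) v ≡ count (_≟S minus) v)

neg : ∀ {m} → Sym m → Sym m
neg plus    = minus
neg minus   = plus
neg (num j) = num (opposite j)

IsSkew : ∀ n → Word n → Set
IsSkew n v = ∀ i → lookup v (opposite i) ≡ neg (lookup v i)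

baseSym : ∀ {m} → Fin m → Sym m → Sym m
baseSym i plus    = plus
baseSym i minus   = minus
baseSym i (num j) = if toℕ i <ᵇ toℕ j then minus else plus

baseClan : ∀ n → Word n → Word n
baseClan n v = tabulate λ i → baseSym i (lookup v i)

stdBase : ∀ n → Word n
stdBase n = tabulate λ i → if toℕ i <ᵇ n then minus else plus

Good : ∀ n → Word n → Set
Good n v = IsClan n v × IsSkew n v × (baseClan n v ≡ stdBase n)

PairOK′? : ∀ {m} (v : Vec (Sym m) m) i s → Dec (PairOK′ v i s)
PairOK′? v i plus    = yes tt
PairOK′? v i minus   = yes tt
PairOK′? v i (num j) = ¬? (j ≟F i) ×-dec (lookup v j ≟S num i)

good? : ∀ n (v : Word n) → Dec (Good n v)
good? n v =
  (all? (λ i → PairOK′? v i (lookup v i)) ×-dec (count (_≟S plus) v ≟ℕ count (_≟S minus) v))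
  ×-dec (all? (λ i → lookup v (opposite i) ≟S neg (lookup v i))
  ×-dec VP.≡-dec _≟S_ (baseClan n v) (stdBase n))

allSyms : ∀ m → List (Sym m)
allSyms m = plus ∷ minus ∷ map num (allFin m)

allVecs : ∀ m k → List (Vec (Sym m) k)
allVecs m zero    = [ [] ]
allVecs m (suc k) = concatMap (λ s → map (s ∷_) (allVecs m k)) (allSyms m)

clanCount : ℕ → ℕ
clanCount n = length (filter (good? n) (allVecs (n + n) (n + n)))

ε : ℕ → ℕ
ε zero    = 1
ε (suc n) = clanCount (suc n)

PS : Set
PS = ℕ → ℚ

sumℚ : List ℚ → ℚ
sumℚ = foldr _+ℚ_ 0ℚ

_⊛_ : PS → PS → PS
(f ⊛ g) n = sumℚ (map (λ k → f k *ℚ g (n ∸ k)) (upTo (suc n)))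

onePS : PS
onePS zero    = 1ℚ
onePS (suc _) = 0ℚ

_^PS_ : PS → ℕ → PS
f ^PS zero    = onePS
f ^PS suc k   = f ⊛ (f ^PS k)

inv! : ℕ → ℚ
inv! k = _/_ (+ 1) (k !) {{k !≢0}}

-- exp f = Σ_k f^k / k!  (for f with zero constant term, the coefficient
-- of x^n only involves k ≤ n)
expPS : PS → PS
expPS f n = sumℚ (map (λ k → (f ^PS k) n *ℚ inv! k) (upTo (suc n)))

twoX+halfX² : PS
twoX+halfX² 1 = + 2 / 1
twoX+halfX² 2 = + 1 / 2
twoX+halfX² _ = 0ℚ

egfCoeff : (ℕ → ℕ) → PS
egfCoeff a n = _/_ (+ a n) (n !) {{n !≢0}}

-- A skew-symmetric clan is determined by its left half. Since the base clan is -ⁿ+ⁿ, every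
-- symbol there is - or a number whose partner lies in the right half, and the partner of a
-- left position l is the mirror image of another left position l′. By skew-symmetry the
-- map l ↦ l′ is a partial involution of {1,…,n}, and every partial involution arises from
-- exactly one such clan. Deciding whether the first point is unmatched, fixed, or
-- exchanged with one of the other n+1 points gives the recurrence a(n+2) = 2a(n+1) + (n+1)a(n).
-- For E = exp(2x + x²/2), i.e. Σₖ (2x + x²/2)ᵏ/k!, the equation E′ = (2 + x)E read
-- coefficientwise is the same recurrence for n!·[xⁿ]E, with the same initial values 1, 2.

module Submission where

open import Defs
open import Relation.Binary.PropositionalEquality
  using (_≡_; _≢_; refl; sym; trans; cong; cong₂; subst; module ≡-Reasoning)

module PartialInvolutions where

  open import Data.Nat using (ℕ; zero; suc; _+_; _*_)
  open import Data.Nat.Tactic.RingSolver using (solve-∀)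
  open import Data.Fin using (Fin; zero; suc; punchIn; punchOut; _≟_)
  open import Data.Fin.Properties
    using (suc-injective; punchInᵢ≢i; punchOut-cong; punchIn-punchOut; punchOut-punchIn; punchIn-injective)
  open import Data.Maybe as Maybe using (Maybe; just; nothing)
  open import Data.Maybe.Properties using (just-injective; map-injective; map-∘)
  open import Data.Product using (∃; _×_; _,_)
  open import Data.Sum using (inj₁; inj₂)
  open import Data.Empty using (⊥-elim)
  open import Function using (_∘_; id; case_of_)
  open import Relation.Nullary using (yes; no)
  open import Data.List using (List; []; _∷_; [_]; map; _++_; length; allFin; cartesianProductWith)
  import Data.List.Properties as List
  open import Data.List.Membership.Propositional using (_∈_; _∉_)
  open import Data.List.Membership.Propositional.Properties
    using (∈-map⁺; ∈-map⁻; ∈-++⁺ˡ; ∈-++⁺ʳ; ∈-++⁻; ∈-allFin; ∈-cartesianProductWith⁺; ∈-cartesianProductWith⁻)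
  open import Data.List.Relation.Unary.Any using (here)
  open import Data.List.Relation.Unary.All using ([])
  open import Data.List.Relation.Unary.AllPairs using ([]; _∷_)
  open import Data.List.Relation.Unary.Unique.Propositional using (Unique)
  open import Data.List.Relation.Unary.Unique.Propositional.Properties
    using (map⁺; ++⁺; allFin⁺; cartesianProductWith⁺)
  open import Data.List.Relation.Binary.Disjoint.Propositional using (Disjoint)
  open ≡-Reasoning

  PartialMap : ℕ → Set
  PartialMap n = Fin n → Maybe (Fin n)

  IsPartialInvolution : ∀ {n} → PartialMap n → Set
  IsPartialInvolution π = ∀ i j → π i ≡ just j → π j ≡ just i

  map-≡just : ∀ {A B : Set} (f : A → B) m {y} → Maybe.map f m ≡ just y → ∃ λ x → m ≡ just x × f x ≡ y
  map-≡just f (just x) refl = x , refl , refl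

  data PunchInView {n} (k : Fin (suc n)) : Fin (suc n) → Set where
    at      : PunchInView k k
    punched : ∀ x → PunchInView k (punchIn k x)

  punchInView : ∀ {n} (k j : Fin (suc n)) → PunchInView k j
  punchInView k j with k ≟ j
  ... | yes refl = at
  ... | no k≢j   = subst (PunchInView k) (punchIn-punchOut k≢j) (punched (punchOut k≢j))

  lower : ∀ {n} → Fin (suc n) → Maybe (Fin (suc n)) → Maybe (Fin n)
  lower p nothing  = nothing
  lower p (just y) with p ≟ y
  ... | yes _   = nothing
  ... | no p≢y  = just (punchOut p≢y)

  lower-≡just : ∀ {n} (p : Fin (suc n)) m {x} → lower p m ≡ just x → m ≡ just (punchIn p x)
  lower-≡just p (just y) eq with p ≟ y
  lower-≡just p (just y) refl | no p≢y = cong just (sym (punchIn-punchOut p≢y))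

  lower-punchIn : ∀ {n} (p : Fin (suc n)) x → lower p (just (punchIn p x)) ≡ just x
  lower-punchIn p x with p ≟ punchIn p x
  ... | yes p≡ = ⊥-elim (punchInᵢ≢i p x (sym p≡))
  ... | no _   = cong just (trans (punchOut-cong p refl) (punchOut-punchIn p))

  map-punchIn-lower : ∀ {n} (p : Fin (suc n)) m → m ≢ just p → Maybe.map (punchIn p) (lower p m) ≡ m
  map-punchIn-lower p nothing  _ = refl
  map-punchIn-lower p (just y) m≢p with p ≟ y
  ... | yes refl = ⊥-elim (m≢p refl)
  ... | no p≢y   = cong just (punchIn-punchOut p≢y)

  remove : ∀ {n} → Fin (suc n) → PartialMap (suc n) → PartialMap n
  remove p π i = lower p (π (punchIn p i))

  remove-involution : ∀ {n} p {π : PartialMap (suc n)} → IsPartialInvolution π → IsPartialInvolution (remove p π)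
  remove-involution p {π} inv i j eq =
    trans (cong (lower p) (inv _ _ (lower-≡just p (π (punchIn p i)) eq))) (lower-punchIn p i)

  map-punchIn-remove : ∀ {n} p (π : PartialMap (suc n)) i → π (punchIn p i) ≢ just p →
                       Maybe.map (punchIn p) (remove p π i) ≡ π (punchIn p i)
  map-punchIn-remove p π i = map-punchIn-lower p (π (punchIn p i))

  -- swap k p exchanges 0 with suc k and acts as p on the remaining points,
  -- numbered through punchIn k.
  data PartialInvolution : ℕ → Set where
    []   : PartialInvolution zero
    skip : ∀ {n} → PartialInvolution n → PartialInvolution (suc n)
    fix  : ∀ {n} → PartialInvolution n → PartialInvolution (suc n)
    swap : ∀ {n} → Fin (suc n) → PartialInvolution n → PartialInvolution (suc (suc n))

  ⟦_⟧ : ∀ {n} → PartialInvolution n → PartialMap n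
  ⟦ skip p ⟧   zero    = nothing
  ⟦ skip p ⟧   (suc i) = Maybe.map suc (⟦ p ⟧ i)
  ⟦ fix p ⟧    zero    = just zero
  ⟦ fix p ⟧    (suc i) = Maybe.map suc (⟦ p ⟧ i)
  ⟦ swap k p ⟧ zero    = just (suc k)
  ⟦ swap k p ⟧ (suc j) with k ≟ j
  ... | yes _   = just zero
  ... | no k≢j  = Maybe.map (suc ∘ punchIn k) (⟦ p ⟧ (punchOut k≢j))

  ⟦swap⟧-partner : ∀ {n} (k : Fin (suc n)) p → ⟦ swap k p ⟧ (suc k) ≡ just zero
  ⟦swap⟧-partner k p with k ≟ k
  ... | yes _  = refl
  ... | no k≢k = ⊥-elim (k≢k refl)

  ⟦swap⟧-punchIn : ∀ {n} (k : Fin (suc n)) p x →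
                   ⟦ swap k p ⟧ (suc (punchIn k x)) ≡ Maybe.map (suc ∘ punchIn k) (⟦ p ⟧ x)
  ⟦swap⟧-punchIn k p x with k ≟ punchIn k x
  ... | yes k≡ = ⊥-elim (punchInᵢ≢i k x (sym k≡))
  ... | no _   = cong (Maybe.map (suc ∘ punchIn k) ∘ ⟦ p ⟧) (trans (punchOut-cong k refl) (punchOut-punchIn k))

  ⟦⟧-involution : ∀ {n} (p : PartialInvolution n) → IsPartialInvolution ⟦ p ⟧
  ⟦⟧-involution (skip p) (suc i) j eq with map-≡just suc (⟦ p ⟧ i) eq
  ... | x , px≡x , refl = cong (Maybe.map suc) (⟦⟧-involution p i x px≡x)
  ⟦⟧-involution (fix p) zero zero refl = refl
  ⟦⟧-involution (fix p) (suc i) j eq with map-≡just suc (⟦ p ⟧ i) eq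
  ... | x , px≡x , refl = cong (Maybe.map suc) (⟦⟧-involution p i x px≡x)
  ⟦⟧-involution (swap k p) zero j refl = ⟦swap⟧-partner k p
  ⟦⟧-involution (swap k p) (suc j) l eq with punchInView k j
  ... | at with trans (sym (⟦swap⟧-partner k p)) eq
  ...   | refl = refl
  ⟦⟧-involution (swap k p) (suc j) l eq | punched x
    with map-≡just (suc ∘ punchIn k) (⟦ p ⟧ x) (trans (sym (⟦swap⟧-punchIn k p x)) eq)
  ... | y , px≡y , refl = trans (⟦swap⟧-punchIn k p y) (cong (Maybe.map (suc ∘ punchIn k)) (⟦⟧-involution p x y px≡y))

  ⟦⟧-injective : ∀ {n} (p q : PartialInvolution n) → (∀ i → ⟦ p ⟧ i ≡ ⟦ q ⟧ i) → p ≡ q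
  ⟦⟧-injective []         []         _ = refl
  ⟦⟧-injective (skip p)   (skip q)   e = cong skip (⟦⟧-injective p q (map-injective suc-injective ∘ e ∘ suc))
  ⟦⟧-injective (fix p)    (fix q)    e = cong fix (⟦⟧-injective p q (map-injective suc-injective ∘ e ∘ suc))
  ⟦⟧-injective (swap k p) (swap l q) e with e zero
  ... | refl = cong (swap k) (⟦⟧-injective p q λ x →
    map-injective (punchIn-injective k _ _ ∘ suc-injective)
      (trans (sym (⟦swap⟧-punchIn k p x)) (trans (e (suc (punchIn k x))) (⟦swap⟧-punchIn k q x))))
  ⟦⟧-injective (skip _)   (fix _)    e with e zero
  ... | ()
  ⟦⟧-injective (skip _)   (swap _ _) e with e zero
  ... | ()
  ⟦⟧-injective (fix _)    (skip _)   e with e zero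
  ... | ()
  ⟦⟧-injective (fix _)    (swap _ _) e with e zero
  ... | ()
  ⟦⟧-injective (swap _ _) (skip _)   e with e zero
  ... | ()
  ⟦⟧-injective (swap _ _) (fix _)    e with e zero
  ... | ()

  ⟦⟧-surjective : ∀ {n} (π : PartialMap n) → IsPartialInvolution π → ∃ λ p → ∀ i → ⟦ p ⟧ i ≡ π i
  ⟦⟧-surjective {zero}  π inv = [] , λ ()
  ⟦⟧-surjective {suc n} π inv with π zero in π0 | ⟦⟧-surjective (remove zero π) (remove-involution zero inv)
  ... | nothing | p , ⟦p⟧≗ = skip p , λ where
    zero    → sym π0
    (suc i) → trans (cong (Maybe.map suc) (⟦p⟧≗ i))
                    (map-punchIn-remove zero π i λ πi≡0 → case (trans (sym π0) (inv _ _ πi≡0)) of λ ())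
  ... | just zero | p , ⟦p⟧≗ = fix p , λ where
    zero    → sym π0
    (suc i) → trans (cong (Maybe.map suc) (⟦p⟧≗ i))
                    (map-punchIn-remove zero π i λ πi≡0 → case (trans (sym π0) (inv _ _ πi≡0)) of λ ())
  ⟦⟧-surjective {suc (suc n)} π inv | just (suc k) | _
    with ⟦⟧-surjective (remove k (remove zero π)) (remove-involution k (remove-involution zero inv))
  ... | p , ⟦p⟧≗ = swap k p , agree
    where
    π′ = remove zero π
    πk≡0 : π (suc k) ≡ just zero
    πk≡0 = inv zero (suc k) π0
    agree : ∀ i → ⟦ swap k p ⟧ i ≡ π i
    agree zero = sym π0
    agree (suc j) with punchInView k j
    ... | at       = trans (⟦swap⟧-partner k p) (sym πk≡0)
    ... | punched x = begin
      ⟦ swap k p ⟧ (suc (punchIn k x))                 ≡⟨ ⟦swap⟧-punchIn k p x ⟩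
      Maybe.map (suc ∘ punchIn k) (⟦ p ⟧ x)            ≡⟨ cong (Maybe.map (suc ∘ punchIn k)) (⟦p⟧≗ x) ⟩
      Maybe.map (suc ∘ punchIn k) (remove k π′ x)      ≡⟨ map-∘ (remove k π′ x) ⟩
      Maybe.map suc (Maybe.map (punchIn k) (remove k π′ x))
        ≡⟨ cong (Maybe.map suc) (map-punchIn-remove k π′ x π′x≢k) ⟩
      Maybe.map suc (π′ (punchIn k x))                 ≡⟨ map-punchIn-remove zero π (punchIn k x) πx≢0 ⟩
      π (suc (punchIn k x))                            ∎
      where
      πx≢0 : π (suc (punchIn k x)) ≢ just zero
      πx≢0 πx≡0 = punchInᵢ≢i k x (suc-injective (just-injective (trans (sym (inv _ _ πx≡0)) π0)))
      π′x≢k : π′ (punchIn k x) ≢ just k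
      π′x≢k π′x≡k with trans (sym πk≡0) (inv _ _ (lower-≡just zero (π (suc (punchIn k x))) π′x≡k))
      ... | ()

  mutual
    allPartialInvolutions : ∀ n → List (PartialInvolution n)
    allPartialInvolutions zero    = [ [] ]
    allPartialInvolutions (suc n) =
      map skip (allPartialInvolutions n) ++ map fix (allPartialInvolutions n) ++ allSwaps n

    allSwaps : ∀ n → List (PartialInvolution (suc n))
    allSwaps zero    = []
    allSwaps (suc n) = cartesianProductWith swap (allFin (suc n)) (allPartialInvolutions n)

  length-cartesianProductWith : ∀ {A B C : Set} (f : A → B → C) xs ys →
                                length (cartesianProductWith f xs ys) ≡ length xs * length ys
  length-cartesianProductWith f []       ys = refl
  length-cartesianProductWith f (x ∷ xs) ys = begin
    length (map (f x) ys ++ cartesianProductWith f xs ys)      ≡⟨ List.length-++ (map (f x) ys) ⟩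
    length (map (f x) ys) + length (cartesianProductWith f xs ys)
      ≡⟨ cong₂ _+_ (List.length-map (f x) ys) (length-cartesianProductWith f xs ys) ⟩
    length ys + length xs * length ys                          ∎

  length-allPartialInvolutions :
    ∀ n → length (allPartialInvolutions (suc (suc n)))
          ≡ 2 * length (allPartialInvolutions (suc n)) + suc n * length (allPartialInvolutions n)
  length-allPartialInvolutions n = begin
    length (map skip P₁ ++ map fix P₁ ++ allSwaps (suc n))
      ≡⟨ List.length-++ (map skip P₁) ⟩
    length (map skip P₁) + length (map fix P₁ ++ allSwaps (suc n))
      ≡⟨ cong (length (map skip P₁) +_) (List.length-++ (map fix P₁)) ⟩
    length (map skip P₁) + (length (map fix P₁) + length (allSwaps (suc n)))
      ≡⟨ cong₂ (λ a b → a + (b + length (allSwaps (suc n)))) (List.length-map skip P₁) (List.length-map fix P₁) ⟩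
    length P₁ + (length P₁ + length (allSwaps (suc n)))
      ≡⟨ cong (λ c → length P₁ + (length P₁ + c))
              (trans (length-cartesianProductWith swap (allFin (suc n)) P₀)
                     (cong (_* length P₀) (List.length-tabulate {n = suc n} id))) ⟩
    length P₁ + (length P₁ + suc n * length P₀)
      ≡⟨ regroup (length P₁) (suc n * length P₀) ⟩
    2 * length P₁ + suc n * length P₀ ∎
    where
    P₀ = allPartialInvolutions n
    P₁ = allPartialInvolutions (suc n)
    regroup : ∀ a b → a + (a + b) ≡ 2 * a + b
    regroup = solve-∀

  ∈-allPartialInvolutions : ∀ {n} (p : PartialInvolution n) → p ∈ allPartialInvolutions n
  ∈-allPartialInvolutions []         = here refl
  ∈-allPartialInvolutions (skip p)   = ∈-++⁺ˡ (∈-map⁺ skip (∈-allPartialInvolutions p))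
  ∈-allPartialInvolutions (fix {n} p)    =
    ∈-++⁺ʳ (map skip (allPartialInvolutions n)) (∈-++⁺ˡ (∈-map⁺ fix (∈-allPartialInvolutions p)))
  ∈-allPartialInvolutions (swap {n} k p) =
    ∈-++⁺ʳ (map skip (allPartialInvolutions (suc n))) (∈-++⁺ʳ (map fix (allPartialInvolutions (suc n)))
      (∈-cartesianProductWith⁺ swap (∈-allFin k) (∈-allPartialInvolutions p)))

  allPartialInvolutions-unique : ∀ n → Unique (allPartialInvolutions n)
  allPartialInvolutions-unique zero    = [] ∷ []
  allPartialInvolutions-unique (suc n) =
    ++⁺ (map⁺ skip-injective Pₙ!) (++⁺ (map⁺ fix-injective Pₙ!) (swaps-unique n) fix#swap) skip#rest
    where
    Pₙ! = allPartialInvolutions-unique n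
    skip-injective : ∀ {n} {p q : PartialInvolution n} → skip p ≡ skip q → p ≡ q
    skip-injective refl = refl
    fix-injective : ∀ {n} {p q : PartialInvolution n} → fix p ≡ fix q → p ≡ q
    fix-injective refl = refl
    swaps-unique : ∀ n → Unique (allSwaps n)
    swaps-unique zero    = []
    swaps-unique (suc n) = cartesianProductWith⁺ swap (λ { refl → refl , refl })
                             (allFin⁺ (suc n)) (allPartialInvolutions-unique n)
    fix∉swaps : ∀ {n} {p : PartialInvolution n} → fix p ∉ allSwaps n
    fix∉swaps {suc m} fp∈ with ∈-cartesianProductWith⁻ swap (allFin (suc m)) (allPartialInvolutions m) fp∈
    ... | _ , _ , _ , _ , ()
    skip∉swaps : ∀ {n} {p : PartialInvolution n} → skip p ∉ allSwaps n
    skip∉swaps {suc m} sp∈ with ∈-cartesianProductWith⁻ swap (allFin (suc m)) (allPartialInvolutions m) sp∈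
    ... | _ , _ , _ , _ , ()
    skip∉fixes : ∀ {n} {p : PartialInvolution n} xs → skip p ∉ map fix xs
    skip∉fixes xs sp∈ with ∈-map⁻ fix {xs = xs} sp∈
    ... | _ , _ , ()
    fix#swap : Disjoint (map fix (allPartialInvolutions n)) (allSwaps n)
    fix#swap (v∈fixes , v∈swaps) with ∈-map⁻ fix v∈fixes
    ... | _ , _ , refl = fix∉swaps v∈swaps
    skip#rest : Disjoint (map skip (allPartialInvolutions n)) (map fix (allPartialInvolutions n) ++ allSwaps n)
    skip#rest (v∈skips , v∈rest) with ∈-map⁻ skip v∈skips
    ... | _ , _ , refl with ∈-++⁻ (map fix (allPartialInvolutions n)) v∈rest
    ...   | inj₁ v∈fixes = skip∉fixes _ v∈fixes
    ...   | inj₂ v∈swaps = skip∉swaps v∈swaps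


module SkewClans where

  open import Data.Nat as ℕ using (ℕ; suc; _+_; _<ᵇ_; _<_; _≤_)
  import Data.Nat.Properties as ℕ
  open import Data.Fin using (Fin; toℕ; opposite; _↑ˡ_; _↑ʳ_; splitAt)
  open import Data.Fin.Properties
    using (toℕ-↑ˡ; toℕ-↑ʳ; toℕ<n; toℕ-injective; opposite-prop; opposite-involutive; join-splitAt; splitAt-↑ˡ; splitAt-↑ʳ)
  import Data.Fin.Permutation as Perm
  open import Data.Vec using (Vec; []; _∷_; lookup; tabulate; count; _++_)
  import Data.Vec.Properties as Vec
  open import Data.Maybe using (Maybe; just; nothing)
  open import Data.Bool using (true; false; if_then_else_)
  open import Data.Sum using (inj₁; inj₂; [_,_]′)
  open import Data.Product using (_,_; proj₁; proj₂)
  open import Data.Unit using (tt)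
  open import Data.Empty using (⊥-elim)
  open import Function using (_∘_; case_of_)
  open import Relation.Nullary using (does)
  open import Relation.Unary using (Decidable)
  open import Algebra.Properties.CommutativeMonoid.Sum ℕ.+-0-commutativeMonoid using (sum; sum-permute; sum-cong-≗)
  open PartialInvolutions using (PartialMap; IsPartialInvolution)
  open ≡-Reasoning

  signAt : ∀ {m} → ℕ → ℕ → Sym m
  signAt a b = if a <ᵇ b then minus else plus

  signAt-< : ∀ {m a b} → a < b → signAt {m} a b ≡ minus
  signAt-< {a = a} {b} a<b with a <ᵇ b | ℕ.<⇒<ᵇ a<b
  ... | true | _ = refl

  signAt-≥ : ∀ {m a b} → b ≤ a → signAt {m} a b ≡ plus
  signAt-≥ {a = a} {b} b≤a with a <ᵇ b | ℕ.<ᵇ⇒< a b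
  ... | false | _   = refl
  ... | true  | a<b = ⊥-elim (ℕ.<⇒≱ (a<b tt) b≤a)

  signAt≡minus⇒< : ∀ {m a b} → signAt {m} a b ≡ minus → a < b
  signAt≡minus⇒< {a = a} {b} eq with a <ᵇ b | ℕ.<ᵇ⇒< a b
  ... | true | a<b = a<b tt
  ... | false | _  = case eq of λ ()

  neg-involutive : ∀ {m} (s : Sym m) → neg (neg s) ≡ s
  neg-involutive plus    = refl
  neg-involutive minus   = refl
  neg-involutive (num j) = cong num (opposite-involutive j)

  indicator : ∀ {A : Set} {P : A → Set} → Decidable P → A → ℕ
  indicator P? x = if does (P? x) then 1 else 0

  count≡sum : ∀ {A : Set} {P : A → Set} (P? : Decidable P) {m} (v : Vec A m) →
              count P? v ≡ sum (indicator P? ∘ lookup v)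
  count≡sum P? []      = refl
  count≡sum P? (x ∷ v) with does (P? x)
  ... | true  = cong suc (count≡sum P? v)
  ... | false = count≡sum P? v

  skew⇒balanced : ∀ {n} {v : Word n} → IsSkew n v → count (_≟S plus) v ≡ count (_≟S minus) v
  skew⇒balanced {v = v} skew = begin
    count (_≟S plus) v                                  ≡⟨ count≡sum (_≟S plus) v ⟩
    sum (indicator (_≟S plus) ∘ lookup v)               ≡⟨ sum-permute (indicator (_≟S plus) ∘ lookup v) Perm.reverse ⟩
    sum (indicator (_≟S plus) ∘ lookup v ∘ opposite)    ≡⟨ sum-cong-≗ (λ i → cong (indicator (_≟S plus)) (skew i)) ⟩
    sum (indicator (_≟S plus) ∘ neg ∘ lookup v)         ≡⟨ sum-cong-≗ (λ i → neg≟plus (lookup v i)) ⟩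
    sum (indicator (_≟S minus) ∘ lookup v)              ≡⟨ count≡sum (_≟S minus) v ⟨
    count (_≟S minus) v                                 ∎
    where
    neg≟plus : ∀ {m} (s : Sym m) → indicator (_≟S plus) (neg s) ≡ indicator (_≟S minus) s
    neg≟plus plus    = refl
    neg≟plus minus   = refl
    neg≟plus (num _) = refl

  PairOK′-opposite : ∀ {n} {v : Word n} → IsSkew n v → ∀ i s → PairOK′ v i s → PairOK′ v (opposite i) (neg s)
  PairOK′-opposite skew i plus    _ = tt
  PairOK′-opposite skew i minus   _ = tt
  PairOK′-opposite skew i (num j) (j≢i , vj≡i) = j≢i ∘ opposite-injective , trans (skew j) (cong neg vj≡i)
    where
    opposite-injective : ∀ {k} {a b : Fin k} → opposite a ≡ opposite b → a ≡ b
    opposite-injective {a = a} {b} eq = trans (sym (opposite-involutive a)) (trans (cong opposite eq) (opposite-involutive b))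

  skew⇒PairOK-opposite : ∀ {n} {v : Word n} → IsSkew n v → ∀ i → PairOK v i → PairOK v (opposite i)
  skew⇒PairOK-opposite {n} {v} skew i ok =
    subst (PairOK′ v (opposite i)) (sym (skew i)) (PairOK′-opposite {n} skew i (lookup v i) ok)

  module _ {n : ℕ} where

    data Half : Fin (n + n) → Set where
      left  : ∀ l → Half (l ↑ˡ n)
      right : ∀ r → Half (n ↑ʳ r)

    half : ∀ i → Half i
    half i with splitAt n i | join-splitAt n n i
    ... | inj₁ l | refl = left l
    ... | inj₂ r | refl = right r

    ↑ˡ≢↑ʳ : ∀ l r → l ↑ˡ n ≢ n ↑ʳ r
    ↑ˡ≢↑ʳ l r eq with trans (sym (splitAt-↑ˡ n l n)) (trans (cong (splitAt n) eq) (splitAt-↑ʳ n n r))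
    ... | ()

    opposite-↑ˡ : ∀ l → opposite (l ↑ˡ n) ≡ n ↑ʳ opposite l
    opposite-↑ˡ l = toℕ-injective (begin
      toℕ (opposite (l ↑ˡ n))   ≡⟨ opposite-prop (l ↑ˡ n) ⟩
      n + n ℕ.∸ suc (toℕ (l ↑ˡ n)) ≡⟨ cong (λ k → n + n ℕ.∸ suc k) (toℕ-↑ˡ l n) ⟩
      n + n ℕ.∸ suc (toℕ l)     ≡⟨ ℕ.+-∸-assoc n (toℕ<n l) ⟩
      n + (n ℕ.∸ suc (toℕ l))   ≡⟨ cong (n +_) (opposite-prop l) ⟨
      n + toℕ (opposite l)      ≡⟨ toℕ-↑ʳ n (opposite l) ⟨
      toℕ (n ↑ʳ opposite l)     ∎)

    ↑ʳ≡opposite-↑ˡ : ∀ r → n ↑ʳ r ≡ opposite (opposite r ↑ˡ n)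
    ↑ʳ≡opposite-↑ˡ r = sym (trans (opposite-↑ˡ (opposite r)) (cong (n ↑ʳ_) (opposite-involutive r)))

    opposite-↑ʳ : ∀ r → opposite (n ↑ʳ r) ≡ opposite r ↑ˡ n
    opposite-↑ʳ r = trans (cong opposite (↑ʳ≡opposite-↑ˡ r)) (opposite-involutive (opposite r ↑ˡ n))

    opposite-↑ʳ-opposite : ∀ l → opposite (n ↑ʳ opposite l) ≡ l ↑ˡ n
    opposite-↑ʳ-opposite l = trans (opposite-↑ʳ (opposite l)) (cong (_↑ˡ n) (opposite-involutive l))

    mirror : (Fin n → Sym (n + n)) → Word n
    mirror L = tabulate L ++ tabulate (neg ∘ L ∘ opposite)

    lookup-mirror-↑ˡ : ∀ L l → lookup (mirror L) (l ↑ˡ n) ≡ L l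
    lookup-mirror-↑ˡ L l = trans (Vec.lookup-++ˡ (tabulate L) _ l) (Vec.lookup∘tabulate L l)

    lookup-mirror-↑ʳ : ∀ L r → lookup (mirror L) (n ↑ʳ r) ≡ neg (L (opposite r))
    lookup-mirror-↑ʳ L r = trans (Vec.lookup-++ʳ (tabulate L) _ r) (Vec.lookup∘tabulate _ r)

    mirror-skew : ∀ L → IsSkew n (mirror L)
    mirror-skew L i = on (half i)
      where
      on : ∀ {i} → Half i → lookup (mirror L) (opposite i) ≡ neg (lookup (mirror L) i)
      on (left l) = begin
        lookup (mirror L) (opposite (l ↑ˡ n))   ≡⟨ cong (lookup (mirror L)) (opposite-↑ˡ l) ⟩
        lookup (mirror L) (n ↑ʳ opposite l)     ≡⟨ lookup-mirror-↑ʳ L (opposite l) ⟩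
        neg (L (opposite (opposite l)))         ≡⟨ cong (neg ∘ L) (opposite-involutive l) ⟩
        neg (L l)                               ≡⟨ cong neg (lookup-mirror-↑ˡ L l) ⟨
        neg (lookup (mirror L) (l ↑ˡ n))        ∎
      on (right r) = begin
        lookup (mirror L) (opposite (n ↑ʳ r))   ≡⟨ cong (lookup (mirror L)) (opposite-↑ʳ r) ⟩
        lookup (mirror L) (opposite r ↑ˡ n)     ≡⟨ lookup-mirror-↑ˡ L (opposite r) ⟩
        L (opposite r)                          ≡⟨ neg-involutive (L (opposite r)) ⟨
        neg (neg (L (opposite r)))              ≡⟨ cong neg (lookup-mirror-↑ʳ L r) ⟨
        neg (lookup (mirror L) (n ↑ʳ r))        ∎

    skew-≡-from-left : ∀ {v w : Word n} → IsSkew n v → IsSkew n w →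
                       (∀ l → lookup v (l ↑ˡ n) ≡ lookup w (l ↑ˡ n)) → v ≡ w
    skew-≡-from-left {v} {w} v-skew w-skew v≡w-left =
      trans (sym (Vec.tabulate∘lookup v)) (trans (Vec.tabulate-cong (λ i → on (half i))) (Vec.tabulate∘lookup w))
      where
      on : ∀ {i} → Half i → lookup v i ≡ lookup w i
      on (left l)  = v≡w-left l
      on (right r) = begin
        lookup v (n ↑ʳ r)                       ≡⟨ cong (lookup v) (↑ʳ≡opposite-↑ˡ r) ⟩
        lookup v (opposite (opposite r ↑ˡ n))   ≡⟨ v-skew (opposite r ↑ˡ n) ⟩
        neg (lookup v (opposite r ↑ˡ n))        ≡⟨ cong neg (v≡w-left (opposite r)) ⟩
        neg (lookup w (opposite r ↑ˡ n))        ≡⟨ w-skew (opposite r ↑ˡ n) ⟨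
        lookup w (opposite (opposite r ↑ˡ n))   ≡⟨ cong (lookup w) (↑ʳ≡opposite-↑ˡ r) ⟨
        lookup w (n ↑ʳ r)                       ∎

    -- The left position l is matched with the mirror image of l′ exactly when π l = just l′.
    leftSym : Maybe (Fin n) → Sym (n + n)
    leftSym nothing   = minus
    leftSym (just l′) = num (n ↑ʳ opposite l′)

    clanOf : PartialMap n → Word n
    clanOf π = mirror (leftSym ∘ π)

    clanOf-cong : ∀ {π π′} → (∀ l → π l ≡ π′ l) → clanOf π ≡ clanOf π′
    clanOf-cong π≗π′ = cong₂ _++_ (Vec.tabulate-cong (cong leftSym ∘ π≗π′))
                                  (Vec.tabulate-cong (cong (neg ∘ leftSym) ∘ π≗π′ ∘ opposite))

    partner : Sym (n + n) → Maybe (Fin n)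
    partner (num j) = [ (λ _ → nothing) , just ∘ opposite ]′ (splitAt n j)
    partner plus    = nothing
    partner minus   = nothing

    partner-↑ʳ : ∀ r → partner (num (n ↑ʳ r)) ≡ just (opposite r)
    partner-↑ʳ r rewrite splitAt-↑ʳ n n r = refl

    partner-leftSym : ∀ m → partner (leftSym m) ≡ m
    partner-leftSym nothing   = refl
    partner-leftSym (just l′) = trans (partner-↑ʳ (opposite l′)) (cong just (opposite-involutive l′))

    involutionOf : Word n → PartialMap n
    involutionOf v l = partner (lookup v (l ↑ˡ n))

    involutionOf-clanOf : ∀ π l → involutionOf (clanOf π) l ≡ π l
    involutionOf-clanOf π l = trans (cong partner (lookup-mirror-↑ˡ (leftSym ∘ π) l)) (partner-leftSym (π l))

    clanOf-injective : ∀ {π π′} → clanOf π ≡ clanOf π′ → ∀ l → π l ≡ π′ l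
    clanOf-injective {π} {π′} eq l =
      trans (sym (involutionOf-clanOf π l)) (trans (cong (λ v → involutionOf v l) eq) (involutionOf-clanOf π′ l))

    lookup-baseClan : ∀ v i → lookup (baseClan n v) i ≡ baseSym i (lookup v i)
    lookup-baseClan v i = Vec.lookup∘tabulate (λ i → baseSym i (lookup v i)) i

    lookup-stdBase : ∀ i → lookup (stdBase n) i ≡ signAt (toℕ i) n
    lookup-stdBase = Vec.lookup∘tabulate (λ i → signAt (toℕ i) n)

    module _ {π : PartialMap n} (inv : IsPartialInvolution π) where

      clanOf-PairOK-↑ˡ : ∀ l → PairOK (clanOf π) (l ↑ˡ n)
      clanOf-PairOK-↑ˡ l = subst (PairOK′ (clanOf π) (l ↑ˡ n)) (sym (lookup-mirror-↑ˡ (leftSym ∘ π) l)) (on (π l) refl)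
        where
        on : ∀ m → π l ≡ m → PairOK′ (clanOf π) (l ↑ˡ n) (leftSym m)
        on nothing   _    = tt
        on (just l′) πl≡l′ = (λ eq → ↑ˡ≢↑ʳ l (opposite l′) (sym eq)) , (begin
          lookup (clanOf π) (n ↑ʳ opposite l′)     ≡⟨ lookup-mirror-↑ʳ (leftSym ∘ π) (opposite l′) ⟩
          neg (leftSym (π (opposite (opposite l′)))) ≡⟨ cong (neg ∘ leftSym ∘ π) (opposite-involutive l′) ⟩
          neg (leftSym (π l′))                     ≡⟨ cong (neg ∘ leftSym) (inv l l′ πl≡l′) ⟩
          num (opposite (n ↑ʳ opposite l))         ≡⟨ cong num (opposite-↑ʳ-opposite l) ⟩
          num (l ↑ˡ n)                             ∎)

      clanOf-PairOK : ∀ i → PairOK (clanOf π) i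
      clanOf-PairOK i = on (half i)
        where
        on : ∀ {i} → Half i → PairOK (clanOf π) i
        on (left l)  = clanOf-PairOK-↑ˡ l
        on (right r) = subst (PairOK (clanOf π)) (sym (↑ʳ≡opposite-↑ˡ r))
          (skew⇒PairOK-opposite {n} (mirror-skew (leftSym ∘ π)) (opposite r ↑ˡ n) (clanOf-PairOK-↑ˡ (opposite r)))

    clanOf-base : ∀ π → baseClan n (clanOf π) ≡ stdBase n
    clanOf-base π = Vec.tabulate-cong (λ i → on (half i))
      where
      on : ∀ {i} → Half i → baseSym i (lookup (clanOf π) i) ≡ signAt (toℕ i) n
      on (left l) rewrite lookup-mirror-↑ˡ (leftSym ∘ π) l | toℕ-↑ˡ l n | signAt-< {n + n} (toℕ<n l) = onL (π l)
        where
        onL : ∀ m → baseSym (l ↑ˡ n) (leftSym m) ≡ minus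
        onL nothing   = refl
        onL (just l′) rewrite toℕ-↑ˡ l n | toℕ-↑ʳ n (opposite l′) = signAt-< (ℕ.<-≤-trans (toℕ<n l) (ℕ.m≤m+n n _))
      on (right r) rewrite lookup-mirror-↑ʳ (leftSym ∘ π) r | toℕ-↑ʳ n r | signAt-≥ {n + n} (ℕ.m≤m+n n (toℕ r)) = onR (π (opposite r))
        where
        onR : ∀ m → baseSym (n ↑ʳ r) (neg (leftSym m)) ≡ plus
        onR nothing   = refl
        onR (just l′) rewrite opposite-↑ʳ (opposite l′) | toℕ-↑ˡ (opposite (opposite l′)) n | toℕ-↑ʳ n r =
          signAt-≥ (ℕ.≤-trans (ℕ.<⇒≤ (toℕ<n (opposite (opposite l′)))) (ℕ.m≤m+n n (toℕ r)))

    clanOf-good : ∀ {π} → IsPartialInvolution π → Good n (clanOf π)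
    clanOf-good {π} inv = (clanOf-PairOK inv , skew⇒balanced {n} {clanOf π} skew) , skew , clanOf-base π
      where
      skew = mirror-skew (leftSym ∘ π)

    module _ {v : Word n} (good : Good n v) where

      private
        pairs : ∀ i → PairOK v i
        pairs = proj₁ (proj₁ good)

        skew : IsSkew n v
        skew = proj₁ (proj₂ good)

        left-minus : ∀ l → baseSym (l ↑ˡ n) (lookup v (l ↑ˡ n)) ≡ minus
        left-minus l = begin
          baseSym (l ↑ˡ n) (lookup v (l ↑ˡ n)) ≡⟨ lookup-baseClan v (l ↑ˡ n) ⟨
          lookup (baseClan n v) (l ↑ˡ n)       ≡⟨ cong (λ w → lookup w (l ↑ˡ n)) (proj₂ (proj₂ good)) ⟩
          lookup (stdBase n) (l ↑ˡ n)          ≡⟨ lookup-stdBase (l ↑ˡ n) ⟩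
          signAt (toℕ (l ↑ˡ n)) n              ≡⟨ cong (λ k → signAt k n) (toℕ-↑ˡ l n) ⟩
          signAt (toℕ l) n                     ≡⟨ signAt-< (toℕ<n l) ⟩
          minus                                ∎

        -- Both ends of a pair in the left half would have to precede each other.
        ¬left-pair : ∀ l l₂ → lookup v (l ↑ˡ n) ≢ num (l₂ ↑ˡ n)
        ¬left-pair l l₂ vl≡l₂ = ℕ.<-asym (before l l₂ vl≡l₂) (before l₂ l vl₂≡l)
          where
          before : ∀ a b → lookup v (a ↑ˡ n) ≡ num (b ↑ˡ n) → toℕ (a ↑ˡ n) < toℕ (b ↑ˡ n)
          before a b va≡b = signAt≡minus⇒< (trans (cong (baseSym (a ↑ˡ n)) (sym va≡b)) (left-minus a))
          vl₂≡l : lookup v (l₂ ↑ˡ n) ≡ num (l ↑ˡ n)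
          vl₂≡l = proj₂ (subst (PairOK′ v (l ↑ˡ n)) vl≡l₂ (pairs (l ↑ˡ n)))

      leftSym-involutionOf : ∀ l → leftSym (involutionOf v l) ≡ lookup v (l ↑ˡ n)
      leftSym-involutionOf l = on (lookup v (l ↑ˡ n)) refl
        where
        onNum : ∀ {j} → Half j → lookup v (l ↑ˡ n) ≡ num j → leftSym (partner (num j)) ≡ num j
        onNum (left l₂) vl≡l₂ = ⊥-elim (¬left-pair l l₂ vl≡l₂)
        onNum (right r) _     = trans (cong leftSym (partner-↑ʳ r)) (cong (num ∘ (n ↑ʳ_)) (opposite-involutive r))
        on : ∀ s → lookup v (l ↑ˡ n) ≡ s → leftSym (partner s) ≡ s
        on plus    vl≡+ = case trans (sym (cong (baseSym (l ↑ˡ n)) vl≡+)) (left-minus l) of λ ()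
        on minus   _    = refl
        on (num j) vl≡j = onNum (half j) vl≡j

      involutionOf-involution : IsPartialInvolution (involutionOf v)
      involutionOf-involution l l′ eq = begin
        partner (lookup v (l′ ↑ˡ n))                       ≡⟨ cong (partner ∘ lookup v) (opposite-↑ʳ-opposite l′) ⟨
        partner (lookup v (opposite (n ↑ʳ opposite l′)))   ≡⟨ cong partner (skew (n ↑ʳ opposite l′)) ⟩
        partner (neg (lookup v (n ↑ʳ opposite l′)))        ≡⟨ cong (partner ∘ neg) v[l′]≡l ⟩
        partner (num (opposite (l ↑ˡ n)))                  ≡⟨ cong (partner ∘ num) (opposite-↑ˡ l) ⟩
        partner (num (n ↑ʳ opposite l))                    ≡⟨ partner-leftSym (just l) ⟩
        just l                                             ∎
        where
        v[l]≡l′ : lookup v (l ↑ˡ n) ≡ num (n ↑ʳ opposite l′)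
        v[l]≡l′ = trans (sym (leftSym-involutionOf l)) (cong leftSym eq)
        v[l′]≡l : lookup v (n ↑ʳ opposite l′) ≡ num (l ↑ˡ n)
        v[l′]≡l = proj₂ (subst (PairOK′ v (l ↑ˡ n)) v[l]≡l′ (pairs (l ↑ˡ n)))

      clanOf-involutionOf : clanOf (involutionOf v) ≡ v
      clanOf-involutionOf = skew-≡-from-left (mirror-skew (leftSym ∘ involutionOf v)) skew
        (λ l → trans (lookup-mirror-↑ˡ (leftSym ∘ involutionOf v) l) (leftSym-involutionOf l))


module ClanCount where

  open import Data.Nat using (zero; suc; _+_)
  open import Data.Vec using (Vec; []; _∷_)
  import Data.Vec.Properties as Vec
  open import Data.List using (List; []; _∷_; map; concatMap; allFin; filter; length; cartesianProductWith; _++_)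
  import Data.List.Properties as List
  open import Data.List.Membership.Propositional using (_∈_)
  open import Data.List.Membership.Propositional.Properties
    using (∈-map⁺; ∈-map⁻; ∈-allFin; ∈-filter⁺; ∈-filter⁻; ∈-cartesianProductWith⁺)
  open import Data.List.Membership.Propositional.Properties.WithK using (unique∧set⇒bag)
  open import Data.List.Relation.Binary.BagAndSetEquality using (∼bag⇒↭)
  open import Data.List.Relation.Binary.Permutation.Propositional.Properties using (↭-length)
  open import Data.List.Relation.Unary.Any using (here; there)
  import Data.List.Relation.Unary.All as All
  open import Data.List.Relation.Unary.AllPairs using ([]; _∷_)
  open import Data.List.Relation.Unary.Unique.Propositional using (Unique)
  open import Data.List.Relation.Unary.Unique.Propositional.Properties using (map⁺; filter⁺; allFin⁺; cartesianProductWith⁺)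
  open import Data.Product using (_,_; proj₂)
  open import Function using (_∘_; _⇔_; mk⇔)
  open PartialInvolutions
  open SkewClans

  unique-same-elements⇒same-length : ∀ {A : Set} {xs ys : List A} → Unique xs → Unique ys →
                                     (∀ {x} → x ∈ xs ⇔ x ∈ ys) → length xs ≡ length ys
  unique-same-elements⇒same-length xs! ys! xs≈ys = ↭-length (∼bag⇒↭ (unique∧set⇒bag xs! ys! xs≈ys))

  ∈-allSyms : ∀ {m} (s : Sym m) → s ∈ allSyms m
  ∈-allSyms plus    = here refl
  ∈-allSyms minus   = there (here refl)
  ∈-allSyms (num j) = there (there (∈-map⁺ num (∈-allFin j)))

  allSyms-unique : ∀ m → Unique (allSyms m)
  allSyms-unique m = All.tabulate plus≢ ∷ All.tabulate minus≢ ∷ map⁺ num-inj (allFin⁺ m)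
    where
    minus≢ : ∀ {s} → s ∈ map num (allFin m) → minus ≢ s
    minus≢ s∈ with ∈-map⁻ num s∈
    ... | _ , _ , refl = λ ()
    plus≢ : ∀ {s} → s ∈ minus ∷ map num (allFin m) → plus ≢ s
    plus≢ (here refl) = λ ()
    plus≢ (there s∈) with ∈-map⁻ num s∈
    ... | _ , _ , refl = λ ()

  allVecs-suc : ∀ m k → allVecs m (suc k) ≡ cartesianProductWith _∷_ (allSyms m) (allVecs m k)
  allVecs-suc m k = go (allSyms m)
    where
    go : ∀ ss → concatMap (λ s → map (s ∷_) (allVecs m k)) ss ≡ cartesianProductWith _∷_ ss (allVecs m k)
    go []       = refl
    go (s ∷ ss) = cong (map (s ∷_) (allVecs m k) ++_) (go ss)

  ∈-allVecs : ∀ {m k} (v : Vec (Sym m) k) → v ∈ allVecs m k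
  ∈-allVecs []               = here refl
  ∈-allVecs {m} {suc k} (s ∷ v) =
    subst (_ ∈_) (sym (allVecs-suc m k)) (∈-cartesianProductWith⁺ _∷_ (∈-allSyms s) (∈-allVecs v))

  allVecs-unique : ∀ m k → Unique (allVecs m k)
  allVecs-unique m zero    = All.[] ∷ []
  allVecs-unique m (suc k) = subst Unique (sym (allVecs-suc m k))
    (cartesianProductWith⁺ _∷_ Vec.∷-injective (allSyms-unique m) (allVecs-unique m k))

  clanCount≡#partialInvolutions : ∀ n → clanCount n ≡ length (allPartialInvolutions n)
  clanCount≡#partialInvolutions n = begin
    length goodWords                             ≡⟨ unique-same-elements⇒same-length goodWords! clans! (mk⇔ to from) ⟩
    length (map clan (allPartialInvolutions n))  ≡⟨ List.length-map clan (allPartialInvolutions n) ⟩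
    length (allPartialInvolutions n)             ∎
    where
    open ≡-Reasoning
    goodWords = filter (good? n) (allVecs (n + n) (n + n))
    clan : PartialInvolution n → Word n
    clan = clanOf ∘ ⟦_⟧
    goodWords! : Unique goodWords
    goodWords! = filter⁺ (good? n) (allVecs-unique (n + n) (n + n))
    clans! : Unique (map clan (allPartialInvolutions n))
    clans! = map⁺ (λ {p} {q} eq → ⟦⟧-injective p q (clanOf-injective eq)) (allPartialInvolutions-unique n)
    to : ∀ {v} → v ∈ goodWords → v ∈ map clan (allPartialInvolutions n)
    to {v} v∈ with proj₂ (∈-filter⁻ (good? n) {xs = allVecs (n + n) (n + n)} v∈)
    ... | good with ⟦⟧-surjective (involutionOf v) (involutionOf-involution {n} good)
    ... | p , ⟦p⟧≗ = subst (_∈ map clan (allPartialInvolutions n))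
                           (trans (clanOf-cong ⟦p⟧≗) (clanOf-involutionOf {n} good))
                           (∈-map⁺ clan (∈-allPartialInvolutions p))
    from : ∀ {v} → v ∈ map clan (allPartialInvolutions n) → v ∈ goodWords
    from v∈ with ∈-map⁻ clan v∈
    ... | p , _ , refl = ∈-filter⁺ (good? n) (∈-allVecs (clan p)) (clanOf-good (⟦⟧-involution p))


module ExponentialGeneratingFunction where

  open import Level using (0ℓ)
  open import Data.Nat as ℕ using (ℕ; zero; suc; _!; NonZero; _<_; s≤s)
  import Data.Nat.Properties as ℕ
  import Data.Nat.Tactic.RingSolver as ℕ
  open import Data.Fin as Fin using (Fin; toℕ)
  import Data.Fin.Properties as Fin
  open import Data.Integer as ℤ using (+_)
  import Data.Integer.Properties as ℤ
  import Data.Integer.Tactic.RingSolver as ℤ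
  open import Data.Rational using (ℚ; 0ℚ; 1ℚ; ½; _/_; _+_; _*_; toℚᵘ)
  open import Data.Rational.Properties
  import Data.Rational.Unnormalised as ℚᵘ
  import Data.Rational.Unnormalised.Properties as ℚᵘ
  open import Data.List using (map; applyUpTo)
  import Data.List.Properties as List
  open import Algebra.Bundles using (CommutativeRing)
  open import Algebra.Properties.Semiring.Sum (CommutativeRing.semiring +-*-commutativeRing)
  open import Tactic.RingSolver using (solve-∀)
  open import Tactic.RingSolver.Core.AlmostCommutativeRing using (AlmostCommutativeRing; fromCommutativeRing)
  open import Relation.Nullary.Decidable using (dec⇒maybe)
  open import Function using (_∘_)
  open ≡-Reasoning

  ℚ-ring : AlmostCommutativeRing 0ℓ 0ℓ
  ℚ-ring = fromCommutativeRing +-*-commutativeRing (λ x → dec⇒maybe (0ℚ ≟ x))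

  fromℕ : ℕ → ℚ
  fromℕ n = + n / 1

  toℚᵘ-/ : ∀ i b → toℚᵘ (i / suc b) ℚᵘ.≃ ℚᵘ.mkℚᵘ i b
  toℚᵘ-/ i b = toℚᵘ-fromℚᵘ (ℚᵘ.mkℚᵘ i b)

  /-≡-/ : ∀ a b c d .{{_ : NonZero b}} .{{_ : NonZero d}} →
          a ℕ.* d ≡ c ℕ.* b → + a / b ≡ + c / d
  /-≡-/ a (suc b) c (suc d) ad≡cb = fromℚᵘ-cong {ℚᵘ.mkℚᵘ (+ a) b} {ℚᵘ.mkℚᵘ (+ c) d} (ℚᵘ.*≡* (begin
    + a ℤ.* + suc d ≡⟨ ℤ.pos-* a (suc d) ⟨
    + (a ℕ.* suc d) ≡⟨ cong +_ ad≡cb ⟩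
    + (c ℕ.* suc b) ≡⟨ ℤ.pos-* c (suc b) ⟩
    + c ℤ.* + suc b ∎))

  /-*-/ : ∀ a b c d .{{_ : NonZero b}} .{{_ : NonZero d}} →
          (+ a / b) * (+ c / d) ≡ (+ (a ℕ.* c) / (b ℕ.* d)) {{ℕ.m*n≢0 b d}}
  /-*-/ a (suc b) c (suc d) = toℚᵘ-injective (ℚᵘ.≃-trans (toℚᵘ-homo-* (+ a / suc b) (+ c / suc d))
    (ℚᵘ.≃-trans (ℚᵘ.*-cong (toℚᵘ-/ (+ a) b) (toℚᵘ-/ (+ c) d))
    (ℚᵘ.≃-trans (ℚᵘ.≃-reflexive (cong (λ i → ℚᵘ.mkℚᵘ i _) (sym (ℤ.pos-* a c))))
      (ℚᵘ.≃-sym (toℚᵘ-/ (+ (a ℕ.* c)) _)))))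

  fromℕ-+ : ∀ a b → fromℕ (a ℕ.+ b) ≡ fromℕ a + fromℕ b
  fromℕ-+ a b = toℚᵘ-injective (ℚᵘ.≃-trans (toℚᵘ-/ (+ (a ℕ.+ b)) 0)
    (ℚᵘ.≃-trans (ℚᵘ.*≡* {ℚᵘ.mkℚᵘ (+ (a ℕ.+ b)) 0} {ℚᵘ.mkℚᵘ (+ a) 0 ℚᵘ.+ ℚᵘ.mkℚᵘ (+ b) 0} cross)
    (ℚᵘ.≃-sym (ℚᵘ.≃-trans (toℚᵘ-homo-+ (fromℕ a) (fromℕ b)) (ℚᵘ.+-cong (toℚᵘ-/ (+ a) 0) (toℚᵘ-/ (+ b) 0))))))
    where
    unit : ∀ x y → (x ℤ.+ y) ℤ.* + 1 ≡ (x ℤ.* + 1 ℤ.+ y ℤ.* + 1) ℤ.* + 1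
    unit = ℤ.solve-∀
    cross : + (a ℕ.+ b) ℤ.* + 1 ≡ (+ a ℤ.* + 1 ℤ.+ + b ℤ.* + 1) ℤ.* + 1
    cross = trans (cong (ℤ._* + 1) (ℤ.pos-+ a b)) (unit (+ a) (+ b))

  fromℕ-* : ∀ a b → fromℕ (a ℕ.* b) ≡ fromℕ a * fromℕ b
  fromℕ-* a b = sym (/-*-/ a 1 b 1)

  fromℕ-suc : ∀ n → fromℕ (suc n) ≡ 1ℚ + fromℕ n
  fromℕ-suc = fromℕ-+ 1

  fromℕ[1+k]*inv![1+k]≡inv![k] : ∀ k → fromℕ (suc k) * inv! (suc k) ≡ inv! k
  fromℕ[1+k]*inv![1+k]≡inv![k] k =
    trans (/-*-/ (suc k) 1 1 (suc k !) {{_}} {{suc k ℕ.!≢0}})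
          (/-≡-/ (suc k ℕ.* 1) (1 ℕ.* suc k !) 1 (k !) {{ℕ.m*n≢0 1 (suc k !) {{_}} {{suc k ℕ.!≢0}}}} {{k ℕ.!≢0}} (cross (suc k) (k !)))
    where
    cross : ∀ m n → m ℕ.* 1 ℕ.* n ≡ 1 ℕ.* (1 ℕ.* (m ℕ.* n))
    cross = ℕ.solve-∀

  egfCoeff≡fromℕ*inv! : ∀ e n → egfCoeff e n ≡ fromℕ (e n) * inv! n
  egfCoeff≡fromℕ*inv! e n =
    sym (trans (/-*-/ (e n) 1 1 (n !) {{_}} {{n ℕ.!≢0}})
               (/-≡-/ (e n ℕ.* 1) (1 ℕ.* n !) (e n) (n !) {{ℕ.m*n≢0 1 (n !) {{_}} {{n ℕ.!≢0}}}} {{n ℕ.!≢0}} (cross (e n) (n !))))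
    where
    cross : ∀ a m → a ℕ.* 1 ℕ.* m ≡ a ℕ.* (1 ℕ.* m)
    cross = ℕ.solve-∀

  fromℕ-suc-cancelˡ : ∀ m {x y} → fromℕ (suc m) * x ≡ fromℕ (suc m) * y → x ≡ y
  fromℕ-suc-cancelˡ m {x} {y} eq = trans (rescale x) (trans (cong (r *_) eq) (sym (rescale y)))
    where
    r = + 1 / suc m
    r*[1+m]≡1 : r * fromℕ (suc m) ≡ 1ℚ
    r*[1+m]≡1 = trans (/-*-/ 1 (suc m) (suc m) 1) (/-≡-/ (1 ℕ.* suc m) (suc m ℕ.* 1) 1 1 (cross (suc m)))
      where
      cross : ∀ n → 1 ℕ.* n ℕ.* 1 ≡ 1 ℕ.* (n ℕ.* 1)
      cross = ℕ.solve-∀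
    rescale : ∀ z → z ≡ r * (fromℕ (suc m) * z)
    rescale z = begin
      z                         ≡⟨ *-identityˡ z ⟨
      1ℚ * z                    ≡⟨ cong (_* z) r*[1+m]≡1 ⟨
      r * fromℕ (suc m) * z     ≡⟨ *-assoc r (fromℕ (suc m)) z ⟩
      r * (fromℕ (suc m) * z)   ∎

  sumℚ-applyUpTo : ∀ g n → sumℚ (applyUpTo g n) ≡ ∑[ i < n ] g (toℕ i)
  sumℚ-applyUpTo g zero    = refl
  sumℚ-applyUpTo g (suc n) = cong (_+_ (g 0)) (sumℚ-applyUpTo (g ∘ suc) n)

  sum-0* : ∀ {n} (h : Fin n → ℚ) → ∑[ i < n ] (0ℚ * h i) ≡ 0ℚ
  sum-0* h = trans (sym (*-distribˡ-sum 0ℚ h)) (*-zeroˡ (sum h))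

  F : PS
  F = twoX+halfX²

  shift : PS → PS
  shift g zero    = 0ℚ
  shift g (suc n) = g n

  F⊛-coeff : ∀ g n → (F ⊛ g) n ≡ fromℕ 2 * shift g n + ½ * shift (shift g) n
  F⊛-coeff g zero          = ring (g 0)
    where
    ring : ∀ x → 0ℚ * x + 0ℚ ≡ fromℕ 2 * 0ℚ + ½ * 0ℚ
    ring = solve-∀ ℚ-ring
  F⊛-coeff g (suc zero)    = ring (g 1) (g 0)
    where
    ring : ∀ x y → 0ℚ * x + (fromℕ 2 * y + 0ℚ) ≡ fromℕ 2 * y + ½ * 0ℚ
    ring = solve-∀ ℚ-ring
  F⊛-coeff g (suc (suc m)) =
    trans (cong (λ t → 0ℚ * g (suc (suc m)) + (fromℕ 2 * g (suc m) + (½ * g m + t))) tail≡0)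
          (ring (g (suc (suc m))) (g (suc m)) (g m))
    where
    tail≡0 : sumℚ (map (λ k → F k * g (suc (suc m) ℕ.∸ k)) (applyUpTo (λ i → suc (suc (suc i))) m)) ≡ 0ℚ
    tail≡0 = trans (cong sumℚ (List.map-applyUpTo _ _ m)) (trans (sumℚ-applyUpTo _ m) (sum-0* {m} (λ i → g (suc (suc m) ℕ.∸ suc (suc (suc (toℕ i)))))))
    ring : ∀ x y z → 0ℚ * x + (fromℕ 2 * y + (½ * z + 0ℚ)) ≡ fromℕ 2 * y + ½ * z
    ring = solve-∀ ℚ-ring

  F^-vanishes : ∀ {k n} → n < k → (F ^PS k) n ≡ 0ℚ
  F^-vanishes {suc k} {zero}        _             = F⊛-coeff (F ^PS k) 0
  F^-vanishes {suc k} {suc zero}    (s≤s 0<k)     =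
    trans (F⊛-coeff (F ^PS k) 1) (cong (λ z → fromℕ 2 * z + ½ * 0ℚ) (F^-vanishes 0<k))
  F^-vanishes {suc k} {suc (suc m)} (s≤s 2+m≤k) =
    trans (F⊛-coeff (F ^PS k) (suc (suc m)))
          (cong₂ (λ y z → fromℕ 2 * y + ½ * z) (F^-vanishes 2+m≤k) (F^-vanishes (ℕ.<-trans (ℕ.n<1+n m) 2+m≤k)))

  -- The coefficient of xⁿ⁻¹ in (F^(k+1))′ = (k+1) F′ F^k, where F′ = 2 + x and shift is multiplication by x.
  F^-derivative : ∀ k n → fromℕ n * (F ^PS suc k) n
                          ≡ fromℕ (suc k) * (fromℕ 2 * shift (F ^PS k) n + shift (shift (F ^PS k)) n)
  F^-derivative zero zero                = refl
  F^-derivative zero (suc zero)          = refl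
  F^-derivative zero (suc (suc zero))    = refl
  F^-derivative zero (suc (suc (suc m))) =
    trans (cong (fromℕ (suc (suc (suc m))) *_) (F⊛-coeff onePS (suc (suc (suc m))))) (*-zeroʳ (fromℕ (suc (suc (suc m)))))
  F^-derivative (suc k) zero             =
    trans (*-zeroˡ ((F ^PS suc (suc k)) 0)) (sym (*-zeroʳ (fromℕ (suc (suc k)))))
  F^-derivative (suc k) (suc zero)       = begin
    fromℕ 1 * (F ^PS suc (suc k)) 1               ≡⟨ cong (fromℕ 1 *_) (F⊛-coeff (F ^PS suc k) 1) ⟩
    fromℕ 1 * (fromℕ 2 * G 0 + ½ * 0ℚ)            ≡⟨ cong (λ z → fromℕ 1 * (fromℕ 2 * z + ½ * 0ℚ)) G0≡0 ⟩
    0ℚ                                            ≡⟨ *-zeroʳ (fromℕ (suc (suc k))) ⟨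
    fromℕ (suc (suc k)) * (fromℕ 2 * 0ℚ + 0ℚ)     ≡⟨ cong (λ z → fromℕ (suc (suc k)) * (fromℕ 2 * z + 0ℚ)) G0≡0 ⟨
    fromℕ (suc (suc k)) * (fromℕ 2 * G 0 + 0ℚ)    ∎
    where
    G = F ^PS suc k
    G0≡0 : G 0 ≡ 0ℚ
    G0≡0 = F^-vanishes {suc k} (s≤s ℕ.z≤n)
  F^-derivative (suc k) (suc (suc m))    = begin
    fromℕ (suc (suc m)) * (F ⊛ G) (suc (suc m))
      ≡⟨ cong₂ _*_ (trans (fromℕ-suc (suc m)) (cong (_+_ 1ℚ) (fromℕ-suc m))) (F⊛-coeff G (suc (suc m))) ⟩
    (1ℚ + (1ℚ + x)) * (fromℕ 2 * G (suc m) + ½ * G m)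
      ≡⟨ expand x (G (suc m)) (G m) ⟩
    fromℕ 2 * ((1ℚ + x) * G (suc m)) + ½ * (x * G m) + R
      ≡⟨ cong₂ (λ u v → fromℕ 2 * u + ½ * v + R)
               (trans (cong (_* G (suc m)) (sym (fromℕ-suc m))) (F^-derivative k (suc m))) (F^-derivative k m) ⟩
    fromℕ 2 * (y * (fromℕ 2 * H m + shift H m)) + ½ * (y * (fromℕ 2 * shift H m + shift (shift H) m)) + R
      ≡⟨ cong (_+ R) (collect y (H m) (shift H m) (shift (shift H) m)) ⟩
    y * (fromℕ 2 * (fromℕ 2 * H m + ½ * shift H m) + (fromℕ 2 * shift H m + ½ * shift (shift H) m)) + R
      ≡⟨ cong₂ (λ u v → y * (fromℕ 2 * u + v) + R) (F⊛-coeff H (suc m)) (F⊛-coeff H m) ⟨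
    y * R + R
      ≡⟨ factor y R ⟩
    (1ℚ + y) * R
      ≡⟨ cong (_* R) (fromℕ-suc (suc k)) ⟨
    fromℕ (suc (suc k)) * R ∎
    where
    G = F ^PS suc k
    H = F ^PS k
    R = fromℕ 2 * G (suc m) + G m
    x = fromℕ m
    y = fromℕ (suc k)
    expand : ∀ x A B → (1ℚ + (1ℚ + x)) * (fromℕ 2 * A + ½ * B)
                       ≡ fromℕ 2 * ((1ℚ + x) * A) + ½ * (x * B) + (fromℕ 2 * A + B)
    expand = solve-∀ ℚ-ring
    collect : ∀ y a b c → fromℕ 2 * (y * (fromℕ 2 * a + b)) + ½ * (y * (fromℕ 2 * b + c))
                          ≡ y * (fromℕ 2 * (fromℕ 2 * a + ½ * b) + (fromℕ 2 * b + ½ * c))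
    collect = solve-∀ ℚ-ring
    factor : ∀ y r → y * r + r ≡ (1ℚ + y) * r
    factor = solve-∀ ℚ-ring

  expPS-as-∑ : ∀ f n → expPS f n ≡ ∑[ k < suc n ] ((f ^PS toℕ k) n * inv! (toℕ k))
  expPS-as-∑ f n = trans (cong sumℚ (List.map-upTo term (suc n))) (sumℚ-applyUpTo term (suc n))
    where
    term : ℕ → ℚ
    term k = (f ^PS k) n * inv! k

  ∑-shift-F^ : ∀ n → ∑[ k < suc n ] (shift (F ^PS toℕ k) n * inv! (toℕ k)) ≡ shift (expPS F) n
  ∑-shift-F^ zero    = refl
  ∑-shift-F^ (suc m) = begin
    ∑[ k < suc (suc m) ] T (toℕ k)
      ≡⟨ sum-init-last {suc m} (T ∘ toℕ) ⟩
    ∑[ k < suc m ] T (toℕ (Fin.inject₁ k)) + T (toℕ (Fin.fromℕ (suc m)))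
      ≡⟨ cong₂ _+_ (sum-cong-≗ {suc m} (cong T ∘ Fin.toℕ-inject₁)) (cong T (Fin.toℕ-fromℕ (suc m))) ⟩
    ∑[ k < suc m ] T (toℕ k) + T (suc m)
      ≡⟨ cong₂ _+_ (sym (expPS-as-∑ F m)) (cong (_* inv! (suc m)) (F^-vanishes (ℕ.n<1+n m))) ⟩
    expPS F m + 0ℚ * inv! (suc m)
      ≡⟨ cong (_+_ (expPS F m)) (*-zeroˡ (inv! (suc m))) ⟩
    expPS F m + 0ℚ
      ≡⟨ +-identityʳ (expPS F m) ⟩
    expPS F m ∎
    where
    T : ℕ → ℚ
    T k = (F ^PS k) m * inv! k

  -- The coefficient of xⁿ in E′ = (2 + x) E, for E = exp F.
  expPS-F-derivative : ∀ n → fromℕ (suc n) * expPS F (suc n) ≡ fromℕ 2 * expPS F n + shift (expPS F) n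
  expPS-F-derivative n = begin
    fromℕ (suc n) * expPS F (suc n)
      ≡⟨ cong (fromℕ (suc n) *_) (trans (expPS-as-∑ F (suc n)) (+-identityˡ _)) ⟩
    fromℕ (suc n) * ∑[ k < suc n ] T (toℕ k)
      ≡⟨ *-distribˡ-sum {suc n} (fromℕ (suc n)) (T ∘ toℕ) ⟩
    ∑[ k < suc n ] (fromℕ (suc n) * T (toℕ k))
      ≡⟨ sum-cong-≗ {suc n} (term ∘ toℕ) ⟩
    ∑[ k < suc n ] (fromℕ 2 * A (toℕ k) + B (toℕ k))
      ≡⟨ ∑-distrib-+ {suc n} (λ k → fromℕ 2 * A (toℕ k)) (B ∘ toℕ) ⟩
    ∑[ k < suc n ] (fromℕ 2 * A (toℕ k)) + ∑[ k < suc n ] B (toℕ k)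
      ≡⟨ cong₂ _+_ (sym (*-distribˡ-sum {suc n} (fromℕ 2) (A ∘ toℕ))) (∑-shift-F^ n) ⟩
    fromℕ 2 * ∑[ k < suc n ] A (toℕ k) + shift (expPS F) n
      ≡⟨ cong (λ z → fromℕ 2 * z + shift (expPS F) n) (expPS-as-∑ F n) ⟨
    fromℕ 2 * expPS F n + shift (expPS F) n ∎
    where
    T A B : ℕ → ℚ
    T k = (F ^PS suc k) (suc n) * inv! (suc k)
    A k = (F ^PS k) n * inv! k
    B k = shift (F ^PS k) n * inv! k
    regroup : ∀ y p q r → y * (fromℕ 2 * p + q) * r ≡ fromℕ 2 * (p * (y * r)) + q * (y * r)
    regroup = solve-∀ ℚ-ring
    term : ∀ k → fromℕ (suc n) * T k ≡ fromℕ 2 * A k + B k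
    term k = begin
      fromℕ (suc n) * ((F ^PS suc k) (suc n) * inv! (suc k))
        ≡⟨ *-assoc (fromℕ (suc n)) _ _ ⟨
      fromℕ (suc n) * (F ^PS suc k) (suc n) * inv! (suc k)
        ≡⟨ cong (_* inv! (suc k)) (F^-derivative k (suc n)) ⟩
      fromℕ (suc k) * (fromℕ 2 * (F ^PS k) n + shift (F ^PS k) n) * inv! (suc k)
        ≡⟨ regroup (fromℕ (suc k)) ((F ^PS k) n) (shift (F ^PS k) n) (inv! (suc k)) ⟩
      fromℕ 2 * ((F ^PS k) n * (fromℕ (suc k) * inv! (suc k))) + shift (F ^PS k) n * (fromℕ (suc k) * inv! (suc k))
        ≡⟨ cong (λ r → fromℕ 2 * ((F ^PS k) n * r) + shift (F ^PS k) n * r) (fromℕ[1+k]*inv![1+k]≡inv![k] k) ⟩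
      fromℕ 2 * A k + B k ∎

  egfCoeff≡expPS-F : (e : ℕ → ℕ) → e 0 ≡ 1 → e 1 ≡ 2 →
                     (∀ n → e (suc (suc n)) ≡ 2 ℕ.* e (suc n) ℕ.+ suc n ℕ.* e n) →
                     ∀ n → egfCoeff e n ≡ expPS F n
  egfCoeff≡expPS-F e e₀ e₁ recurrence n = trans (egfCoeff≡fromℕ*inv! e n) (sym (expPS-F≡ n))
    where
    expPS-F≡ : ∀ n → expPS F n ≡ fromℕ (e n) * inv! n
    expPS-F≡ zero             = cong (λ z → fromℕ z * inv! 0) (sym e₀)
    expPS-F≡ (suc zero)       = cong (λ z → fromℕ z * inv! 1) (sym e₁)
    expPS-F≡ (suc (suc n)) = fromℕ-suc-cancelˡ (suc n) (begin
      fromℕ (suc (suc n)) * expPS F (suc (suc n))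
        ≡⟨ expPS-F-derivative (suc n) ⟩
      fromℕ 2 * expPS F (suc n) + expPS F n
        ≡⟨ cong₂ (λ u v → fromℕ 2 * u + v) (expPS-F≡ (suc n)) (expPS-F≡ n) ⟩
      fromℕ 2 * (a * I) + b * inv! n
        ≡⟨ cong (λ z → fromℕ 2 * (a * I) + b * z) (fromℕ[1+k]*inv![1+k]≡inv![k] n) ⟨
      fromℕ 2 * (a * I) + b * (fromℕ (suc n) * I)
        ≡⟨ factor a b (fromℕ (suc n)) I ⟩
      (fromℕ 2 * a + fromℕ (suc n) * b) * I
        ≡⟨ cong (_* I) recurrenceℚ ⟨
      fromℕ (e (suc (suc n))) * I
        ≡⟨ cong (fromℕ (e (suc (suc n))) *_) (fromℕ[1+k]*inv![1+k]≡inv![k] (suc n)) ⟨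
      fromℕ (e (suc (suc n))) * (fromℕ (suc (suc n)) * inv! (suc (suc n)))
        ≡⟨ swap (fromℕ (e (suc (suc n)))) (fromℕ (suc (suc n))) (inv! (suc (suc n))) ⟩
      fromℕ (suc (suc n)) * (fromℕ (e (suc (suc n))) * inv! (suc (suc n))) ∎)
      where
      a = fromℕ (e (suc n))
      b = fromℕ (e n)
      I = inv! (suc n)
      recurrenceℚ : fromℕ (e (suc (suc n))) ≡ fromℕ 2 * a + fromℕ (suc n) * b
      recurrenceℚ = trans (cong fromℕ (recurrence n))
        (trans (fromℕ-+ (2 ℕ.* e (suc n)) (suc n ℕ.* e n)) (cong₂ _+_ (fromℕ-* 2 (e (suc n))) (fromℕ-* (suc n) (e n))))
      factor : ∀ a b c i → fromℕ 2 * (a * i) + b * (c * i) ≡ (fromℕ 2 * a + c * b) * i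
      factor = solve-∀ ℚ-ring
      swap : ∀ a c i → a * (c * i) ≡ c * (a * i)
      swap = solve-∀ ℚ-ring


open import Data.Nat using (ℕ; zero; suc; _+_; _*_)
open import Data.Product using (_×_; _,_)
open import Data.List using (length)
open PartialInvolutions using (allPartialInvolutions; length-allPartialInvolutions)
open ClanCount using (clanCount≡#partialInvolutions)
open ExponentialGeneratingFunction using (egfCoeff≡expPS-F)

ε≡#partialInvolutions : ∀ n → ε n ≡ length (allPartialInvolutions n)
ε≡#partialInvolutions zero    = refl
ε≡#partialInvolutions (suc n) = clanCount≡#partialInvolutions (suc n)

ε-recurrence : ∀ n → ε (suc (suc n)) ≡ 2 * ε (suc n) + suc n * ε n
ε-recurrence n = begin
  ε (suc (suc n))                                 ≡⟨ ε≡#partialInvolutions (suc (suc n)) ⟩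
  length (allPartialInvolutions (suc (suc n)))    ≡⟨ length-allPartialInvolutions n ⟩
  2 * length (allPartialInvolutions (suc n)) + suc n * length (allPartialInvolutions n)
    ≡⟨ cong₂ (λ a b → 2 * a + suc n * b) (ε≡#partialInvolutions (suc n)) (ε≡#partialInvolutions n) ⟨
  2 * ε (suc n) + suc n * ε n                     ∎
  where open ≡-Reasoning

corollary6p5 : ((n : ℕ) → ε (suc (suc n)) ≡ 2 * ε (suc n) + (suc n) * ε n)
    × ((n : ℕ) → egfCoeff ε n ≡ expPS twoX+halfX² n)
corollary6p5 = ε-recurrence , egfCoeff≡expPS-F ε refl (ε≡#partialInvolutions 1) ε-recurrence
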